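{- Let $p,h\ge1$ be integers and $\delta,\tau\in(0,1)$ reals with $\tau\ge2^{ -h}$. Let $\mathcal{A},\mathcal{B}$ be finite sets and $g:\mathcal{A}\times\mathcal{B}\to\{0,1\}$ a (possibly partial) function with $(\delta,h)$-hitting monochromatic rectangle-distributions. Let $A\times B\subseteq\mathcal{A}^p\times\mathcal{B}^p$ be a non-empty rectangle with $A$ and $B$ both $\tau$-thick. Then for every $z\in\{0,1\}^p$ there is $(a,b)\in A\times B$ such that $g(a_j,b_j)$ is defined and equals $z_j$ for every $j\in[p]$.
   Context: For $a\in\mathcal{A}^p$ and $j\in[p]$, $a_{\neq j}$ is $a$ with coordinate $j$ removed, $A_{\neq j}=\{a_{\neq j}:a\in A\}$, and for $a'\in A_{\neq j}$, $\mathrm{Ext}^j_A(a')$ is the set of $x\in\mathcal{A}$ such that inserting $x$ at position $j$ of $a'$ gives an element of $A$. For $p\ge2$, $A$ is $\tau$-thick if $\min_{a'\in A_{\neq j}}|\mathrm{Ext}^j_A(a')|\ge\tau|\mathcal{A}|$ for all $j\in[p]$; for $p=1$, $A\subseteq\mathcal{A}$ is $\tau$-thick if $|A|\ge\tau|\mathcal{A}|$. Likewise for subsets of $\mathcal{B}^p$ relative to $|\mathcal{B}|$. A rectangle $U\times V\subseteq\mathcal{A}\times\mathcal{B}$ is $c$-monochromatic if $g(u,v)$ is defined and equals $c$ on $U\times V$. A distribution $\sigma$ over rectangles is $(\delta,h)$-hitting if for all $X\subseteq\mathcal{A}$, $Y\subseteq\mathcal{B}$ of densities $|X|/|\mathcal{A}|,|Y|/|\mathcal{B}|\ge2^{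 -h}$, $\Pr_{R\sim\sigma}[R\cap(X\times Y)\ne\emptyset]\ge1-\delta$; $g$ has $(\delta,h)$-hitting monochromatic rectangle-distributions if there exist $(\delta,h)$-hitting $\sigma_0,\sigma_1$ with $\sigma_c$ supported on $c$-monochromatic rectangles. -}

module Defs where

open import Level using (Level; _⊔_; suc)
open import Data.Nat as ℕ using (ℕ; zero; _^_) renaming (suc to sucℕ)
open import Data.Bool using (Bool; true; false; _∨_; if_then_else_)
open import Data.Maybe using (Maybe; just)
open import Data.Fin using (Fin)
open import Data.Fin.Subset using (Subset; _∈_; ∣_∣)
open import Data.Vec using (Vec; []; _∷_; insertAt; tabulate)
open import Data.List using (List; []; _∷_)
open import Data.List.Relation.Unary.All using (All)
open import Data.Product using (_×_; _,_; ∃; Σ)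
open import Relation.Binary.PropositionalEquality using (_≡_)
open import Relation.Binary.Structures using (IsTotalOrder)
open import Relation.Nullary using (¬_)
open import Algebra.Bundles using (CommutativeRing)

-- Ordered fields (the paper's reals ℝ are one instance).  We state the
-- lemma for an arbitrary ordered field, which includes ℝ.

record OrderedField (c ℓ : Level) : Set (suc (c ⊔ ℓ)) where
  field
    commutativeRing : CommutativeRing c ℓ
  open CommutativeRing commutativeRing public
  field
    _≤_          : Carrier → Carrier → Set ℓ
    isTotalOrder : IsTotalOrder _≈_ _≤_
    +-mono-≤     : ∀ {x y} z → x ≤ y → (x + z) ≤ (y + z)
    *-nonneg     : ∀ {x y} → 0# ≤ x → 0# ≤ y → 0# ≤ (x * y)
    nontrivial   : ¬ (0# ≈ 1#)
    inverse      : ∀ x → ¬ (x ≈ 0#) → ∃ λ y → (x * y) ≈ 1#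

  _<_ : Carrier → Carrier → Set ℓ
  x < y = (x ≤ y) × ¬ (x ≈ y)

  fromℕ : ℕ → Carrier
  fromℕ zero     = 0#
  fromℕ (sucℕ n) = 1# + fromℕ n

-- Finite sets 𝒜 = Fin m, 𝓑 = Fin n; partial g : 𝒜 × 𝓑 → {0,1}
-- is modelled as Fin m → Fin n → Maybe Bool (nothing = undefined).

PartialFun : ℕ → ℕ → Set
PartialFun m n = Fin m → Fin n → Maybe Bool

Rect : ℕ → ℕ → Set
Rect m n = Subset m × Subset n

Monochromatic : ∀ {m n} → PartialFun m n → Bool → Rect m n → Set
Monochromatic g c (U , V) = ∀ u v → u ∈ U → v ∈ V → g u v ≡ just c

nonemptyᵇ : ∀ {k} → Subset k → Bool
nonemptyᵇ []       = false
nonemptyᵇ (b ∷ bs) = b ∨ nonemptyᵇ bs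

open import Data.Fin.Subset using (_∩_)
open import Data.Bool using (_∧_)

meetsᵇ : ∀ {m n} → Rect m n → Subset m → Subset n → Bool
meetsᵇ (U , V) X Y = nonemptyᵇ (U ∩ X) ∧ nonemptyᵇ (V ∩ Y)

module _ {c ℓ} (F : OrderedField c ℓ) where
  open OrderedField F

  -- A finitely supported distribution over rectangles: a list of
  -- (weight, rectangle) pairs, weights nonnegative, summing to 1.
  Dist : ℕ → ℕ → Set c
  Dist m n = List (Carrier × Rect m n)

  totalWeight : ∀ {m n} → Dist m n → Carrier
  totalWeight []             = 0#
  totalWeight ((w , _) ∷ σ)  = w + totalWeight σ

  IsDistribution : ∀ {m n} → Dist m n → Set (c ⊔ ℓ)
  IsDistribution σ = All (λ e → 0# ≤ Data.Product.proj₁ e) σ × (totalWeight σ ≈ 1#)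

  probMeets : ∀ {m n} → Dist m n → Subset m → Subset n → Carrier
  probMeets []             X Y = 0#
  probMeets ((w , R) ∷ σ)  X Y =
    (if meetsᵇ R X Y then w else 0#) + probMeets σ X Y

  SupportedOnMono : ∀ {m n} → PartialFun m n → Bool → Dist m n → Set (c ⊔ ℓ)
  SupportedOnMono g b σ =
    All (λ e → ¬ (Data.Product.proj₁ e ≈ 0#) → Monochromatic g b (Data.Product.proj₂ e)) σ

  -- (δ,h)-hitting: for all X, Y of densities ≥ 2^{-h}
  -- (written |X| · 2^h ≥ |𝒜|, i.e. |X|/|𝒜| ≥ 2^{-h} with denominators cleared)
  Hitting : ∀ {m n} → Carrier → ℕ → Dist m n → Set ℓ
  Hitting {m} {n} δ h σ =
    ∀ (X : Subset m) (Y : Subset n) →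
      fromℕ m ≤ (fromℕ ∣ X ∣ * fromℕ (2 ^ h)) →
      fromℕ n ≤ (fromℕ ∣ Y ∣ * fromℕ (2 ^ h)) →
      (1# - δ) ≤ probMeets σ X Y

  HasHittingMonoDists : ∀ {m n} → PartialFun m n → Carrier → ℕ → Set (c ⊔ ℓ)
  HasHittingMonoDists {m} {n} g δ h =
    Σ (Dist m n) λ σ₀ → Σ (Dist m n) λ σ₁ →
      IsDistribution σ₀ × SupportedOnMono g false σ₀ × Hitting δ h σ₀ ×
      IsDistribution σ₁ × SupportedOnMono g true  σ₁ × Hitting δ h σ₁

  Ext : ∀ {m q} → (Vec (Fin m) (sucℕ q) → Bool) → Fin (sucℕ q) → Vec (Fin m) q → Subset m
  Ext A j a' = tabulate (λ x → A (insertAt a' j x))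

  -- τ-thick subsets of (Fin m)^p, given by characteristic functions.
  -- p = 1: |A| ≥ τ|𝒜|;  p ≥ 2: for all j and all a' ∈ A_{≠j},
  -- |Ext^j_A(a')| ≥ τ|𝒜|.
  -- (only p ≥ 1 is meaningful; the exponent is written p = suc q)
  Thick : ∀ {m q} → Carrier → (Vec (Fin m) (sucℕ q) → Bool) → Set ℓ
  Thick {m} {zero} τ A =
    (τ * fromℕ m) ≤ fromℕ ∣ tabulate (λ x → A (x ∷ [])) ∣
  Thick {m} {sucℕ q} τ A =
    ∀ (j : Fin (sucℕ (sucℕ q))) (a' : Vec (Fin m) (sucℕ q)) →
      (∃ λ x → A (insertAt a' j x) ≡ true) →
      (τ * fromℕ m) ≤ fromℕ ∣ Ext A j a' ∣

module Submission where

-- Call a pair (X , Y) of subsets of 𝒜 and 𝓑 *τ-dense* when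
-- |X| ≥ τ|𝒜| and |Y| ≥ τ|𝓑|.  Since τ·2^h ≥ 1, τ-dense sets have density at
-- least 2^{-h}, so a (δ,h)-hitting distribution σ_c meets X × Y with
-- probability ≥ 1 - δ > 0.  Every rectangle of positive weight is
-- c-monochromatic, hence X × Y contains a point (x , y) with g(x,y) = c.
--
-- Thickness is exactly what makes this one-coordinate fact iterate: for
-- a ∈ A the extension set Ext¹_A(a_{≠1}) is τ-dense, and fixing the first
-- coordinate x of A gives a slice {v : (x ∷ v) ∈ A} that is again τ-thick.
-- Choosing (x , y) in the two extension sets with g(x,y) = z₁ and recursing
-- on the slices yields (a , b) ∈ A × B with g(a_j , b_j) = z_j for all j.

open import Defs
open import Level using (Level)
open import Data.Nat using (ℕ; suc; _≤_)
open import Data.Bool using (Bool; true; false; _∧_)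
open import Data.Maybe using (just)
open import Data.Fin using (Fin; zero)
open import Data.Vec using (Vec; lookup; []; _∷_; tabulate; here; there)
open import Data.Product using (_×_; ∃; ∃₂; _,_)
open import Relation.Binary.PropositionalEquality using (_≡_)

import Data.Nat as ℕ
import Data.Fin as Fin
import Data.Bool as Bool
import Data.List as List
open import Data.Vec.Properties using (lookup∘tabulate; []=⇒lookup)
open import Data.Fin.Properties using (any?)
open import Data.Fin.Subset using (Subset; _∈_; _∩_; ∣_∣; Nonempty)
open import Data.Fin.Subset.Properties using (x∈p∩q⁻; _∈?_)
open import Data.Maybe.Properties using (≡-dec)
open import Data.List.Relation.Unary.All using ([]; _∷_)
open import Data.Sum using (inj₁; inj₂)
open import Data.Empty using (⊥-elim)
open import Relation.Nullary using (¬_; Dec; yes; no)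
open import Relation.Nullary.Decidable using (_×-dec_)
import Relation.Binary.PropositionalEquality as ≡
open import Relation.Binary.Structures using (IsTotalOrder)

∧-true : ∀ {a b} → a ∧ b ≡ true → (a ≡ true) × (b ≡ true)
∧-true {true} {true} ≡.refl = ≡.refl , ≡.refl

nonemptyᵇ⇒Nonempty : ∀ {k} (S : Subset k) → nonemptyᵇ S ≡ true → Nonempty S
nonemptyᵇ⇒Nonempty (true ∷ S)  _ = zero , here
nonemptyᵇ⇒Nonempty (false ∷ S) e with nonemptyᵇ⇒Nonempty S e
... | i , i∈S = Fin.suc i , there i∈S

meets⇒commonPoint : ∀ {m n} (U : Subset m) (V : Subset n) X Y →
  meetsᵇ (U , V) X Y ≡ true →
  ∃₂ λ u v → (u ∈ U) × (u ∈ X) × (v ∈ V) × (v ∈ Y)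
meets⇒commonPoint U V X Y meets
  with ∧-true {nonemptyᵇ (U ∩ X)} meets
... | UX , VY with nonemptyᵇ⇒Nonempty (U ∩ X) UX | nonemptyᵇ⇒Nonempty (V ∩ Y) VY
... | u , u∈U∩X | v , v∈V∩Y with x∈p∩q⁻ U X u∈U∩X | x∈p∩q⁻ V Y v∈V∩Y
... | u∈U , u∈X | v∈V , v∈Y = u , v , u∈U , u∈X , v∈V , v∈Y

ColouredPoint : ∀ {m n} → PartialFun m n → Bool → Subset m → Subset n → Set
ColouredPoint g b X Y = ∃₂ λ x y → (x ∈ X) × (y ∈ Y) × (g x y ≡ just b)

colouredPoint? : ∀ {m n} (g : PartialFun m n) b X Y →
  Dec (ColouredPoint g b X Y)
colouredPoint? g b X Y =
  any? λ x → any? λ y → (x ∈? X) ×-dec ((y ∈? Y) ×-dec ≡-dec Bool._≟_ (g x y) (just b))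

∈Ext₀ : ∀ {k q} (A : Vec (Fin k) (suc q) → Bool) (a' : Vec (Fin k) q) x →
  x ∈ tabulate (λ y → A (y ∷ a')) → A (x ∷ a') ≡ true
∈Ext₀ A a' x x∈ = ≡.trans (≡.sym (lookup∘tabulate (λ y → A (y ∷ a')) x)) ([]=⇒lookup x∈)

module OrderedFieldFacts {c ℓ} (F : OrderedField c ℓ) where
  open OrderedField F renaming (_≤_ to infix 4 _≼_)
  open IsTotalOrder isTotalOrder using (antisym; total)
    renaming (trans to ≼-trans; reflexive to ≼-reflexive)
  open import Algebra.Properties.Ring ring using (-1*x≈-x; -‿involutive)
  open import Relation.Binary.Reasoning.Setoid setoid

  ≼-respʳ : ∀ {x y z} → x ≼ y → y ≈ z → x ≼ z
  ≼-respʳ p q = ≼-trans p (≼-reflexive q)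

  ≼-respˡ : ∀ {x y z} → x ≈ y → y ≼ z → x ≼ z
  ≼-respˡ q p = ≼-trans (≼-reflexive q) p

  ≼⇒0≼- : ∀ {x y} → x ≼ y → 0# ≼ y - x
  ≼⇒0≼- {x} p = ≼-respˡ (sym (-‿inverseʳ x)) (+-mono-≤ (- x) p)

  -- Squares are nonnegative, so 1 = (-1)·(-1) rules out 1 < 0.
  0≼1 : 0# ≼ 1#
  0≼1 with total 0# 1#
  ... | inj₁ 0≼1 = 0≼1
  ... | inj₂ 1≼0 = ⊥-elim (nontrivial (antisym 0≼1′ 1≼0))
    where
    0≼-1 : 0# ≼ - 1#
    0≼-1 = ≼-respʳ (≼⇒0≼- 1≼0) (+-identityˡ _)
    0≼1′ : 0# ≼ 1#
    0≼1′ = ≼-respʳ (*-nonneg 0≼-1 0≼-1) (trans (-1*x≈-x (- 1#)) (-‿involutive 1#))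

  +-mono₂-≼ : ∀ {a b c d} → a ≼ b → c ≼ d → a + c ≼ b + d
  +-mono₂-≼ {a} {b} {c} {d} p q =
    ≼-trans (+-mono-≤ c p) (≼-respˡ (+-comm b c) (≼-respʳ (+-mono-≤ b q) (+-comm d b)))

  0≼fromℕ : ∀ k → 0# ≼ fromℕ k
  0≼fromℕ ℕ.zero    = ≼-reflexive refl
  0≼fromℕ (ℕ.suc k) = ≼-respˡ (sym (+-identityˡ 0#)) (+-mono₂-≼ 0≼1 (0≼fromℕ k))

  -- Multiplication by a nonnegative element is monotone:
  -- y·z = (y - x)·z + x·z with (y - x)·z ≥ 0.
  *-monoʳ-≼ : ∀ {x y z} → x ≼ y → 0# ≼ z → x * z ≼ y * z
  *-monoʳ-≼ {x} {y} {z} p 0≼z =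
    ≼-respˡ (sym (+-identityˡ _)) (≼-respʳ (+-mono-≤ (x * z) (*-nonneg (≼⇒0≼- p) 0≼z)) split)
    where
    split : (y - x) * z + x * z ≈ y * z
    split = begin
      (y - x) * z + x * z       ≈⟨ +-congʳ (distribʳ z y (- x)) ⟩
      (y * z + - x * z) + x * z ≈⟨ +-assoc _ _ _ ⟩
      y * z + (- x * z + x * z) ≈⟨ +-congˡ (sym (distribʳ z (- x) x)) ⟩
      y * z + (- x + x) * z     ≈⟨ +-congˡ (*-congʳ (-‿inverseˡ x)) ⟩
      y * z + 0# * z            ≈⟨ +-congˡ (zeroˡ z) ⟩
      y * z + 0#                ≈⟨ +-identityʳ _ ⟩
      y * z                     ∎

  1-δ≼0⇒δ≈1 : ∀ {δ} → δ ≼ 1# → 1# - δ ≼ 0# → δ ≈ 1#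
  1-δ≼0⇒δ≈1 {δ} δ≼1 le = begin
    δ                ≈⟨ sym (+-identityˡ δ) ⟩
    0# + δ           ≈⟨ +-congʳ (sym (antisym le (≼⇒0≼- δ≼1))) ⟩
    (1# - δ) + δ     ≈⟨ +-assoc _ _ _ ⟩
    1# + (- δ + δ)   ≈⟨ +-congˡ (-‿inverseˡ δ) ⟩
    1# + 0#          ≈⟨ +-identityʳ 1# ⟩
    1#               ∎

  dense⇒2^-h-dense : ∀ (τ : Carrier) h k s → 1# ≼ τ * fromℕ (2 ℕ.^ h) →
    τ * fromℕ k ≼ fromℕ s → fromℕ k ≼ fromℕ s * fromℕ (2 ℕ.^ h)
  dense⇒2^-h-dense τ h k s τ2^h≥1 dense =
    ≼-respˡ (sym (*-identityˡ _))
      (≼-trans (*-monoʳ-≼ τ2^h≥1 (0≼fromℕ k))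
        (≼-respˡ reassoc (*-monoʳ-≼ dense (0≼fromℕ (2 ℕ.^ h)))))
    where
    reassoc : (τ * fromℕ (2 ℕ.^ h)) * fromℕ k ≈ (τ * fromℕ k) * fromℕ (2 ℕ.^ h)
    reassoc = begin
      (τ * fromℕ (2 ℕ.^ h)) * fromℕ k ≈⟨ *-assoc _ _ _ ⟩
      τ * (fromℕ (2 ℕ.^ h) * fromℕ k) ≈⟨ *-congˡ (*-comm _ _) ⟩
      τ * (fromℕ k * fromℕ (2 ℕ.^ h)) ≈⟨ sym (*-assoc _ _ _) ⟩
      (τ * fromℕ k) * fromℕ (2 ℕ.^ h) ∎

module Colouring {c ℓ} (F : OrderedField c ℓ) where
  open OrderedField F hiding (zero) renaming (_≤_ to infix 4 _≼_)
  open OrderedFieldFacts F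

  module _ {m n} (g : PartialFun m n) (b : Bool) (X : Subset m) (Y : Subset n) where

    -- Without a b-coloured point in X × Y, every rectangle of the support
    -- misses X × Y, so each summand of probMeets vanishes.  Whether a weight
    -- is zero is not decidable, hence the double negation.
    noPoint⇒probMeets≈0 : ∀ σ → SupportedOnMono F g b σ → ¬ ColouredPoint g b X Y →
      ¬ ¬ (probMeets F σ X Y ≈ 0#)
    noPoint⇒probMeets≈0 List.[] _ _ k = k refl
    noPoint⇒probMeets≈0 ((w , (U , V)) List.∷ σ) (mono ∷ monos) noPoint k
      with meetsᵇ (U , V) X Y in meets
    ... | false = noPoint⇒probMeets≈0 σ monos noPoint (λ rest → k (trans (+-congˡ rest) (+-identityˡ 0#)))
    ... | true with meets⇒commonPoint U V X Y meets
    ... | u , v , u∈U , u∈X , v∈V , v∈Y =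
      noPoint (u , v , u∈X , v∈Y , mono w≉0 u v u∈U v∈V)
      where
      w≉0 : ¬ (w ≈ 0#)
      w≉0 w≈0 = noPoint⇒probMeets≈0 σ monos noPoint
        (λ rest → k (trans (+-cong w≈0 rest) (+-identityˡ 0#)))

    hitting⇒colouredPoint : ∀ δ → δ < 1# → (σ : Dist F m n) → SupportedOnMono F g b σ →
      1# - δ ≼ probMeets F σ X Y → ColouredPoint g b X Y
    hitting⇒colouredPoint δ (δ≼1 , δ≉1) σ monos hits with colouredPoint? g b X Y
    ... | yes point  = point
    ... | no noPoint = ⊥-elim (noPoint⇒probMeets≈0 σ monos noPoint
                         (λ p≈0 → δ≉1 (1-δ≼0⇒δ≈1 δ≼1 (≼-respʳ hits p≈0))))

  Dense : ∀ {k} → Carrier → Subset k → Set ℓ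
  Dense {k} τ X = τ * fromℕ k ≼ fromℕ ∣ X ∣

  DenseRectanglesColoured : ∀ {m n} → PartialFun m n → Carrier → Set ℓ
  DenseRectanglesColoured g τ = ∀ b X Y → Dense τ X → Dense τ Y → ColouredPoint g b X Y

  hitting⇒denseColoured : ∀ {m n} (g : PartialFun m n) δ τ h → δ < 1# →
    1# ≼ τ * fromℕ (2 ℕ.^ h) → HasHittingMonoDists F g δ h → DenseRectanglesColoured g τ
  hitting⇒denseColoured {m} {n} g δ τ h δ<1 τ2^h≥1 (σ₀ , σ₁ , _ , mono₀ , hit₀ , _ , mono₁ , hit₁) b X Y dX dY
    = hitting⇒colouredPoint g b X Y δ δ<1 (σ b) (mono b) (hit b X Y (dense⇒ m X dX) (dense⇒ n Y dY))
    where
    dense⇒ : ∀ k (S : Subset k) → Dense τ S → fromℕ k ≼ fromℕ ∣ S ∣ * fromℕ (2 ℕ.^ h)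
    dense⇒ k S = dense⇒2^-h-dense τ h k ∣ S ∣ τ2^h≥1
    σ : Bool → Dist F m n
    σ false = σ₀
    σ true  = σ₁
    mono : ∀ b → SupportedOnMono F g b (σ b)
    mono false = mono₀
    mono true  = mono₁
    hit : ∀ b → Hitting F δ h (σ b)
    hit false = hit₀
    hit true  = hit₁

  sliceThick : ∀ {k q} (τ : Carrier) (A : Vec (Fin k) (suc (suc q)) → Bool) x →
    (∃ λ v → A (x ∷ v) ≡ true) → Thick F τ A → Thick F τ (λ v → A (x ∷ v))
  sliceThick {q = ℕ.zero}  τ A x (y ∷ [] , x∷y∈A) thick = thick (Fin.suc zero) (x ∷ []) (y , x∷y∈A)
  sliceThick {q = ℕ.suc q} τ A x _ thick = λ j a' ext → thick (Fin.suc j) (x ∷ a') ext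

  -- The first coordinates are
  -- found in the τ-dense extension sets of given elements, the rest in slices.
  colouredTuple : ∀ {m n} (g : PartialFun m n) τ → DenseRectanglesColoured g τ →
    ∀ q (A : Vec (Fin m) (suc q) → Bool) (B : Vec (Fin n) (suc q) → Bool) →
    (∃ λ a → A a ≡ true) → (∃ λ b → B b ≡ true) →
    Thick F τ A → Thick F τ B → (z : Vec Bool (suc q)) →
    ∃₂ λ a b → (A a ≡ true) × (B b ≡ true) ×
      (∀ (j : Fin (suc q)) → g (lookup a j) (lookup b j) ≡ just (lookup z j))
  colouredTuple g τ coloured ℕ.zero A B _ _ thickA thickB (b ∷ [])
    with coloured b (tabulate λ x → A (x ∷ [])) (tabulate λ y → B (y ∷ [])) thickA thickB
  ... | x , y , x∈ , y∈ , gxy =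
    (x ∷ []) , (y ∷ []) , ∈Ext₀ A [] x x∈ , ∈Ext₀ B [] y y∈ , λ { zero → gxy }
  colouredTuple g τ coloured (ℕ.suc q) A B (x₀ ∷ a' , a∈A) (y₀ ∷ b' , b∈B) thickA thickB (b ∷ z)
    with coloured b (Ext F A zero a') (Ext F B zero b')
                    (thickA zero a' (x₀ , a∈A)) (thickB zero b' (y₀ , b∈B))
  ... | x , y , x∈ , y∈ , gxy
    with ∈Ext₀ A a' x x∈ | ∈Ext₀ B b' y y∈
  ... | x∷a'∈A | y∷b'∈B
    with colouredTuple g τ coloured q (λ v → A (x ∷ v)) (λ v → B (y ∷ v))
           (a' , x∷a'∈A) (b' , y∷b'∈B)
           (sliceThick τ A x (a' , x∷a'∈A) thickA) (sliceThick τ B y (b' , y∷b'∈B) thickB) z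
  ... | a , b , a∈ , b∈ , gab = (x ∷ a) , (y ∷ b) , a∈ , b∈ , λ { zero → gxy ; (Fin.suc j) → gab j }

lemma4 : ∀ {c ℓ : Level} (F : OrderedField c ℓ) (q h m n : ℕ)
    (δ τ : OrderedField.Carrier F) →
    1 ≤ h →
    OrderedField._<_ F (OrderedField.0# F) δ → OrderedField._<_ F δ (OrderedField.1# F) →
    OrderedField._<_ F (OrderedField.0# F) τ → OrderedField._<_ F τ (OrderedField.1# F) →
    OrderedField._≤_ F (OrderedField.1# F) (OrderedField._*_ F τ (OrderedField.fromℕ F (2 Data.Nat.^ h))) →
    (g : PartialFun m n) →
    HasHittingMonoDists F g δ h →
    (A : Vec (Fin m) (suc q) → Bool) (B : Vec (Fin n) (suc q) → Bool) →
    (∃ λ a → A a ≡ true) → (∃ λ b → B b ≡ true) →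
    Thick F τ A → Thick F τ B →
    (z : Vec Bool (suc q)) →
    ∃₂ λ a b → (A a ≡ true) × (B b ≡ true) ×
    (∀ (j : Fin (suc q)) → g (lookup a j) (lookup b j) ≡ just (lookup z j))
lemma4 F q h m n δ τ _ _ δ<1 _ _ τ2^h≥1 g hitting =
  colouredTuple g τ (hitting⇒denseColoured g δ τ h δ<1 τ2^h≥1 hitting) q
  where open Colouring F
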